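{- Let $P$ be a Dyck path of size $n$, and let $d$ be a down step of $P$ immediately followed by an up step $u$. Let $S$ be the excursion of $u$ in $P$, and let $Q$ be the path obtained from $P$ by swapping $d$ and $S$. Let $u'$ be the up step of $P$ matched with $d$ (i.e. $d$ is the final step of the excursion of $u'$), and let $i_0$ be the rank of $u'$ in $P$. Then $D_Q(i)=D_P(i)$ for every $i\neq i_0$, and $D_Q(i_0)=D_P(i_0)+\ell_P(u)$.
   Context: A Dyck path of size $n$ is a path of $n$ up steps $(1,1)$ and $n$ down steps $(1,-1)$ from $(0,0)$ to $(2n,0)$ never going below the $x$-axis. For an up step $u$ of a Dyck path $P$, the excursion of $u$ in $P$ is the shortest factor of $P$ starting with $u$ that is a (translated) Dyck path; $\ell_P(u)$ is its size (number of up steps in it); the final step of the excursion is said to be matched with $u$. An up step has rank $i$ if it is the $i$-th up step of $P$. The distance function of $P$ is $D_P(i)=\ell_P(u_i)$, where $u_i$ is the up step of rank $i$. -}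

module Defs where

open import Data.Nat using (ℕ; zero; suc; _+_; _<_)
open import Data.List using (List; []; _∷_; _++_; length; take)
open import Data.Product using (Σ; _×_; _,_)
open import Data.Empty using (⊥)
open import Data.Unit using (⊤)
open import Relation.Binary.PropositionalEquality using (_≡_)
open import Relation.Nullary using (¬_)

data Step : Set where
  U D : Step

countU : List Step → ℕ
countU []       = 0
countU (U ∷ w)  = suc (countU w)
countU (D ∷ w)  = countU w

ValidFrom : ℕ → List Step → Set
ValidFrom zero    []      = ⊤
ValidFrom (suc h) []      = ⊥
ValidFrom h       (U ∷ w) = ValidFrom (suc h) w
ValidFrom zero    (D ∷ w) = ⊥
ValidFrom (suc h) (D ∷ w) = ValidFrom h w

IsDyck : List Step → Set
IsDyck w = ValidFrom 0 w

DyckOfSize : ℕ → List Step → Set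
DyckOfSize n w = IsDyck w × countU w ≡ n

-- Positions are 0-based indices into the list of steps.
Excursion : List Step → ℕ → List Step → Set
Excursion P p S =
  Σ (List Step) λ A → Σ (List Step) λ B → Σ (List Step) λ S' →
    (P ≡ A ++ S ++ B) × (length A ≡ p) × (S ≡ U ∷ S') × IsDyck S ×
    (∀ k → 0 < k → k < length S → ¬ IsDyck (take k S))

-- Rank P p i : the step of P at position p is an up step of rank i
-- (it is the i-th up step of P, ranks starting at 1).
Rank : List Step → ℕ → ℕ → Set
Rank P p i =
  Σ (List Step) λ A → Σ (List Step) λ B →
    (P ≡ A ++ U ∷ B) × (length A ≡ p) × (suc (countU A) ≡ i)

module Submission where

-- Write P = X u′ M d S B, where u′ M d is the excursion of u′ (so M is a Dyck path) and S is a
-- Dyck path; then Q = X u′ M S d B. The excursion of an up step ends where the steps after it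
-- first go below its height. An up step inside M or S has its excursion closed inside that Dyck
-- factor, before the swap matters. For an up step in X or B, the factor u′ M d S resp. u′ M S d
-- is in both cases a Dyck path with the same number of up steps, which the excursion either
-- never reaches or crosses without going below its height. Only u′ is affected: its excursion
-- used to end at d and now contains S as well. Nothing beyond M and S being Dyck paths is used;
-- in particular P itself need not be a Dyck path.

open import Defs
open import Data.Nat using (ℕ; zero; suc; _+_; _<_; s≤s; z≤n)
open import Data.Nat.Properties using (suc-injective; +-identityʳ; +-comm; <-≤-connex; m≤n⇒∃[o]m+o≡n)
open import Data.List using (List; []; _∷_; _++_; length; take)
open import Data.List.Properties using (++-assoc; ++-cancelʳ; length-++; ∷-injective)
open import Data.Product using (∃; _×_; _,_; proj₁)
open import Data.Sum using (_⊎_; inj₁; inj₂)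
open import Data.Empty using (⊥-elim)
open import Relation.Nullary using (¬_)
open import Relation.Binary.PropositionalEquality
  using (_≡_; _≢_; refl; sym; trans; cong; subst; module ≡-Reasoning)
open ≡-Reasoning

upsToExit : ℕ → List Step → ℕ
upsToExit h       []      = 0
upsToExit h       (U ∷ w) = suc (upsToExit (suc h) w)
upsToExit zero    (D ∷ w) = 0
upsToExit (suc h) (D ∷ w) = upsToExit h w

-- suffixAfter r w : the steps of w after its (r + 1)-th up step.
suffixAfter : ℕ → List Step → List Step
suffixAfter r       []      = []
suffixAfter r       (D ∷ w) = suffixAfter r w
suffixAfter zero    (U ∷ w) = w
suffixAfter (suc r) (U ∷ w) = suffixAfter r w

-- The distance function D_w: an up step followed by w has an excursion with
-- suc (upsToExit 0 w) up steps. The values at 0 and beyond the size of w are junk.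
distance : List Step → ℕ → ℕ
distance w zero    = 0
distance w (suc r) = suc (upsToExit 0 (suffixAfter r w))

SameDistances : List Step → List Step → Set
SameDistances Z Z′ = ∀ i → distance Z i ≡ distance Z′ i

countU-++ : ∀ X Y → countU (X ++ Y) ≡ countU X + countU Y
countU-++ []      Y = refl
countU-++ (U ∷ X) Y = cong suc (countU-++ X Y)
countU-++ (D ∷ X) Y = countU-++ X Y

++-injective : ∀ {A : Set} (X X′ Y Y′ : List A) →
  X ++ Y ≡ X′ ++ Y′ → length X ≡ length X′ → X ≡ X′ × Y ≡ Y′
++-injective []      []        Y Y′ e _ = refl , e
++-injective (x ∷ X) (x′ ∷ X′) Y Y′ e l with ∷-injective e
... | refl , e′ with ++-injective X X′ Y Y′ e′ (suc-injective l)
... | refl , refl = refl , refl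

<-or-∃+ : ∀ m n → m < n ⊎ ∃ λ t → n + t ≡ m
<-or-∃+ m n with <-≤-connex m n
... | inj₁ m<n = inj₁ m<n
... | inj₂ n≤m = inj₂ (m≤n⇒∃[o]m+o≡n n≤m)

upsToExit-++-valid : ∀ h k W Z → ValidFrom h W →
  upsToExit (h + k) (W ++ Z) ≡ countU W + upsToExit k Z
upsToExit-++-valid zero    k []      Z _ = refl
upsToExit-++-valid zero    k (U ∷ W) Z v = cong suc (upsToExit-++-valid 1 k W Z v)
upsToExit-++-valid (suc h) k (U ∷ W) Z v = cong suc (upsToExit-++-valid (suc (suc h)) k W Z v)
upsToExit-++-valid (suc h) k (D ∷ W) Z v = upsToExit-++-valid h k W Z v

-- Y ends j + h + 1 levels below where it starts, so read from height j it goes below 0 inside Y.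
upsToExit-exits-in-prefix : ∀ j h Y Z Z′ → ValidFrom (suc (j + h)) Y →
  upsToExit j (Y ++ Z) ≡ upsToExit j (Y ++ Z′)
upsToExit-exits-in-prefix j       h (U ∷ Y) Z Z′ v =
  cong suc (upsToExit-exits-in-prefix (suc j) h Y Z Z′ v)
upsToExit-exits-in-prefix zero    h (D ∷ Y) Z Z′ v = refl
upsToExit-exits-in-prefix (suc j) h (D ∷ Y) Z Z′ v = upsToExit-exits-in-prefix j h Y Z Z′ v

upsToExit-++-congʳ : ∀ {Z Z′} → (∀ k → upsToExit k Z ≡ upsToExit k Z′) →
  ∀ h Y → upsToExit h (Y ++ Z) ≡ upsToExit h (Y ++ Z′)
upsToExit-++-congʳ eq h       []      = eq h
upsToExit-++-congʳ eq h       (U ∷ Y) = cong suc (upsToExit-++-congʳ eq (suc h) Y)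
upsToExit-++-congʳ eq zero    (D ∷ Y) = refl
upsToExit-++-congʳ eq (suc h) (D ∷ Y) = upsToExit-++-congʳ eq h Y

suffixAfter-++ʳ : ∀ X t Z → suffixAfter (countU X + t) (X ++ Z) ≡ suffixAfter t Z
suffixAfter-++ʳ []      t Z = refl
suffixAfter-++ʳ (U ∷ X) t Z = suffixAfter-++ʳ X t Z
suffixAfter-++ʳ (D ∷ X) t Z = suffixAfter-++ʳ X t Z

suffixAfter-++ˡ : ∀ X r Z → r < countU X → suffixAfter r (X ++ Z) ≡ suffixAfter r X ++ Z
suffixAfter-++ˡ (U ∷ X) zero    Z _         = refl
suffixAfter-++ˡ (U ∷ X) (suc r) Z (s≤s r<) = suffixAfter-++ˡ X r Z r<
suffixAfter-++ˡ (D ∷ X) r       Z r<        = suffixAfter-++ˡ X r Z r<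

upsToExit-suffixAfter-closes : ∀ h W r Z Z′ → ValidFrom h W → r < countU W →
  upsToExit 0 (suffixAfter r W ++ Z) ≡ upsToExit 0 (suffixAfter r W ++ Z′)
upsToExit-suffixAfter-closes zero    (U ∷ W) zero    Z Z′ v _ =
  upsToExit-exits-in-prefix 0 0 W Z Z′ v
upsToExit-suffixAfter-closes (suc h) (U ∷ W) zero    Z Z′ v _ =
  upsToExit-exits-in-prefix 0 (suc h) W Z Z′ v
upsToExit-suffixAfter-closes zero    (U ∷ W) (suc r) Z Z′ v (s≤s r<) =
  upsToExit-suffixAfter-closes 1 W r Z Z′ v r<
upsToExit-suffixAfter-closes (suc h) (U ∷ W) (suc r) Z Z′ v (s≤s r<) =
  upsToExit-suffixAfter-closes (suc (suc h)) W r Z Z′ v r<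
upsToExit-suffixAfter-closes (suc h) (D ∷ W) r       Z Z′ v r< =
  upsToExit-suffixAfter-closes h W r Z Z′ v r<

distance-++ʳ : ∀ X Z t → distance (X ++ Z) (suc (countU X + t)) ≡ distance Z (suc t)
distance-++ʳ X Z t = cong (λ w → suc (upsToExit 0 w)) (suffixAfter-++ʳ X t Z)

distance-rank : ∀ X T → distance (X ++ U ∷ T) (suc (countU X)) ≡ suc (upsToExit 0 T)
distance-rank X T =
  subst (λ r → distance (X ++ U ∷ T) (suc r) ≡ _) (+-identityʳ (countU X)) (distance-++ʳ X (U ∷ T) 0)

distance-D∷ : ∀ w i → distance (D ∷ w) i ≡ distance w i
distance-D∷ w zero    = refl
distance-D∷ w (suc r) = refl

sameDistances-Dyck-++ : ∀ W {Z Z′} → IsDyck W → SameDistances Z Z′ → SameDistances (W ++ Z) (W ++ Z′)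
sameDistances-Dyck-++ W dyck same zero = refl
sameDistances-Dyck-++ W {Z} {Z′} dyck same (suc r) with <-or-∃+ r (countU W)
... | inj₁ r< = cong suc (begin
  upsToExit 0 (suffixAfter r (W ++ Z))  ≡⟨ cong (upsToExit 0) (suffixAfter-++ˡ W r Z r<) ⟩
  upsToExit 0 (suffixAfter r W ++ Z)    ≡⟨ upsToExit-suffixAfter-closes 0 W r Z Z′ dyck r< ⟩
  upsToExit 0 (suffixAfter r W ++ Z′)   ≡⟨ cong (upsToExit 0) (suffixAfter-++ˡ W r Z′ r<) ⟨
  upsToExit 0 (suffixAfter r (W ++ Z′)) ∎)
... | inj₂ (t , refl) = begin
  distance (W ++ Z) (suc (countU W + t))  ≡⟨ distance-++ʳ W Z t ⟩
  distance Z (suc t)                      ≡⟨ same (suc t) ⟩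
  distance Z′ (suc t)                     ≡⟨ distance-++ʳ W Z′ t ⟨
  distance (W ++ Z′) (suc (countU W + t)) ∎

distance-++-U∷ : ∀ X {T T′} → (∀ k → upsToExit (suc k) T ≡ upsToExit (suc k) T′) →
  SameDistances T T′ → ∀ i → i ≢ suc (countU X) → distance (X ++ U ∷ T) i ≡ distance (X ++ U ∷ T′) i
distance-++-U∷ X ups same zero    _ = refl
distance-++-U∷ X {T} {T′} ups same (suc r) r≢ with <-or-∃+ r (countU X)
... | inj₁ r< = cong suc (begin
  upsToExit 0 (suffixAfter r (X ++ U ∷ T))   ≡⟨ cong (upsToExit 0) (suffixAfter-++ˡ X r (U ∷ T) r<) ⟩
  upsToExit 0 (suffixAfter r X ++ U ∷ T)
    ≡⟨ upsToExit-++-congʳ (λ k → cong suc (ups k)) 0 (suffixAfter r X) ⟩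
  upsToExit 0 (suffixAfter r X ++ U ∷ T′)    ≡⟨ cong (upsToExit 0) (suffixAfter-++ˡ X r (U ∷ T′) r<) ⟨
  upsToExit 0 (suffixAfter r (X ++ U ∷ T′))  ∎)
... | inj₂ (zero , refl) = ⊥-elim (r≢ (cong suc (+-identityʳ (countU X))))
... | inj₂ (suc t , refl) = begin
  distance (X ++ U ∷ T) (suc (countU X + suc t))   ≡⟨ distance-++ʳ X (U ∷ T) (suc t) ⟩
  distance T (suc t)                              ≡⟨ same (suc t) ⟩
  distance T′ (suc t)                             ≡⟨ distance-++ʳ X (U ∷ T′) (suc t) ⟨
  distance (X ++ U ∷ T′) (suc (countU X + suc t))  ∎

upsToExit-swap : ∀ M S B k → IsDyck M → IsDyck S →
  upsToExit (suc k) (M ++ D ∷ S ++ B) ≡ upsToExit (suc k) (M ++ S ++ D ∷ B)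
upsToExit-swap M S B k dyckM dyckS = begin
  upsToExit (suc k) (M ++ D ∷ S ++ B)        ≡⟨ upsToExit-++-valid 0 (suc k) M (D ∷ S ++ B) dyckM ⟩
  countU M + upsToExit k (S ++ B)            ≡⟨ cong (countU M +_) (upsToExit-++-valid 0 k S B dyckS) ⟩
  countU M + (countU S + upsToExit k B)
    ≡⟨ cong (countU M +_) (upsToExit-++-valid 0 (suc k) S (D ∷ B) dyckS) ⟨
  countU M + upsToExit (suc k) (S ++ D ∷ B)  ≡⟨ upsToExit-++-valid 0 (suc k) M (S ++ D ∷ B) dyckM ⟨
  upsToExit (suc k) (M ++ S ++ D ∷ B)        ∎

upsToExit-swap-matched : ∀ M S B → IsDyck M → IsDyck S →
  upsToExit 0 (M ++ S ++ D ∷ B) ≡ upsToExit 0 (M ++ D ∷ S ++ B) + countU S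
upsToExit-swap-matched M S B dyckM dyckS = begin
  upsToExit 0 (M ++ S ++ D ∷ B)        ≡⟨ upsToExit-++-valid 0 0 M (S ++ D ∷ B) dyckM ⟩
  countU M + upsToExit 0 (S ++ D ∷ B)  ≡⟨ cong (countU M +_) (upsToExit-++-valid 0 0 S (D ∷ B) dyckS) ⟩
  countU M + (countU S + 0)            ≡⟨ cong (countU M +_) (+-identityʳ (countU S)) ⟩
  countU M + countU S                  ≡⟨ cong (_+ countU S) (+-identityʳ (countU M)) ⟨
  countU M + 0 + countU S
    ≡⟨ cong (_+ countU S) (upsToExit-++-valid 0 0 M (D ∷ S ++ B) dyckM) ⟨
  upsToExit 0 (M ++ D ∷ S ++ B) + countU S ∎

sameDistances-swap : ∀ M S B → IsDyck M → IsDyck S →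
  SameDistances (M ++ D ∷ S ++ B) (M ++ S ++ D ∷ B)
sameDistances-swap M S B dyckM dyckS = sameDistances-Dyck-++ M dyckM λ i →
  trans (distance-D∷ (S ++ B) i) (sameDistances-Dyck-++ S dyckS (λ j → sym (distance-D∷ B j)) i)

distance-swap-unmatched : ∀ X M S B → IsDyck M → IsDyck S → ∀ i → i ≢ suc (countU X) →
  distance (X ++ U ∷ M ++ S ++ D ∷ B) i ≡ distance (X ++ U ∷ M ++ D ∷ S ++ B) i
distance-swap-unmatched X M S B dyckM dyckS i i≢ = sym (distance-++-U∷ X
  (λ k → upsToExit-swap M S B k dyckM dyckS) (sameDistances-swap M S B dyckM dyckS) i i≢)

distance-swap-matched : ∀ X M S B → IsDyck M → IsDyck S →
  distance (X ++ U ∷ M ++ S ++ D ∷ B) (suc (countU X))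
    ≡ distance (X ++ U ∷ M ++ D ∷ S ++ B) (suc (countU X)) + countU S
distance-swap-matched X M S B dyckM dyckS = begin
  distance (X ++ U ∷ M ++ S ++ D ∷ B) (suc (countU X))  ≡⟨ distance-rank X (M ++ S ++ D ∷ B) ⟩
  suc (upsToExit 0 (M ++ S ++ D ∷ B))                   ≡⟨ cong suc (upsToExit-swap-matched M S B dyckM dyckS) ⟩
  suc (upsToExit 0 (M ++ D ∷ S ++ B) + countU S)
    ≡⟨ cong (_+ countU S) (distance-rank X (M ++ D ∷ S ++ B)) ⟨
  distance (X ++ U ∷ M ++ D ∷ S ++ B) (suc (countU X)) + countU S ∎

-- The first visit to height 0 at the very end forces a final D, before which the path stays at
-- height ≥ 1, i.e. is valid from one level lower.
minimal-valid-shape : ∀ h w → ValidFrom (suc h) w →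
  (∀ m → m < length w → ¬ ValidFrom (suc h) (take m w)) → ∃ λ v → w ≡ v ++ D ∷ [] × ValidFrom h v
minimal-valid-shape zero    (U ∷ w)     valid minimal
  with minimal-valid-shape 1 w valid (λ m m< → minimal (suc m) (s≤s m<))
... | v , refl , valid′ = U ∷ v , refl , valid′
minimal-valid-shape (suc h) (U ∷ w)     valid minimal
  with minimal-valid-shape (suc (suc h)) w valid (λ m m< → minimal (suc m) (s≤s m<))
... | v , refl , valid′ = U ∷ v , refl , valid′
minimal-valid-shape zero    (D ∷ [])    _     _       = [] , refl , _
minimal-valid-shape zero    (D ∷ _ ∷ _) _     minimal = ⊥-elim (minimal 1 (s≤s (s≤s z≤n)) _)
minimal-valid-shape (suc h) (D ∷ w)     valid minimal
  with minimal-valid-shape h w valid (λ m m< → minimal (suc m) (s≤s m<))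
... | v , refl , valid′ = D ∷ v , refl , valid′

excursion-shape : ∀ {P p E} → Excursion P p E →
  ∃ λ X → ∃ λ M → ∃ λ Y → P ≡ X ++ E ++ Y × length X ≡ p × E ≡ U ∷ M ++ D ∷ [] × IsDyck M
excursion-shape (X , Y , E′ , eP , lX , refl , valid , minimal)
  with minimal-valid-shape 0 E′ valid (λ m m< → minimal (suc m) (s≤s z≤n) (s≤s m<))
... | M , refl , dyck = X , M , Y , eP , lX , refl , dyck

excursion-size : ∀ {P p i E} → Rank P p i → Excursion P p E → countU E ≡ distance P i
excursion-size (X , Z , refl , refl , refl) excursion with excursion-shape excursion
... | X′ , M , Y , eP , lX′ , refl , dyck with ++-injective X X′ (U ∷ Z) _ eP (sym lX′)
... | refl , refl = begin
  suc (countU (M ++ D ∷ []))              ≡⟨ cong suc (countU-++ M (D ∷ [])) ⟩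
  suc (countU M + 0)                      ≡⟨ cong suc (upsToExit-++-valid 0 0 M (D ∷ Y) dyck) ⟨
  suc (upsToExit 0 (M ++ D ∷ Y))          ≡⟨ cong (λ w → suc (upsToExit 0 w)) (++-assoc M (D ∷ []) Y) ⟨
  suc (upsToExit 0 ((M ++ D ∷ []) ++ Y))  ≡⟨ distance-rank X _ ⟨
  distance (X ++ U ∷ (M ++ D ∷ []) ++ Y) (suc (countU X)) ∎

-- The length hypothesis says that the excursion X u′ M d of the up step at q ends with the D
-- following A, so that A = X u′ M.
matched-upStep : ∀ {A W q i₀ E} → Rank (A ++ D ∷ W) q i₀ → Excursion (A ++ D ∷ W) q E →
  q + length E ≡ suc (length A) → ∃ λ X → ∃ λ M → A ≡ X ++ U ∷ M × suc (countU X) ≡ i₀ × IsDyck M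
matched-upStep {A} {W} (X , Z , eP , refl , refl) excursion len with excursion-shape excursion
... | X′ , M , Y , eP′ , lX′ , refl , dyck with ++-injective X X′ (U ∷ Z) _ (trans (sym eP) eP′) (sym lX′)
... | refl , _ = X , M , A≡ , refl , dyck
  where
  prefix≡ : (X ++ U ∷ M ++ D ∷ []) ++ Y ≡ (A ++ D ∷ []) ++ W
  prefix≡ = trans (++-assoc X _ Y) (trans (sym eP′) (sym (++-assoc A (D ∷ []) W)))

  length≡ : length (X ++ U ∷ M ++ D ∷ []) ≡ length (A ++ D ∷ [])
  length≡ = trans (length-++ X) (trans len (trans (+-comm 1 (length A)) (sym (length-++ A))))

  A≡ : A ≡ X ++ U ∷ M
  A≡ = sym (++-cancelʳ (D ∷ []) (X ++ U ∷ M) A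
    (trans (++-assoc X (U ∷ M) (D ∷ [])) (proj₁ (++-injective _ _ Y W prefix≡ length≡))))

lemma2p4 : (n : ℕ) (P : List Step) → DyckOfSize n P →
    (A S B : List Step) → P ≡ A ++ D ∷ S ++ B →
    Excursion P (suc (length A)) S →
    (q i₀ : ℕ) (E : List Step) → Rank P q i₀ → Excursion P q E →
    q + length E ≡ suc (length A) →
    (i p p′ : ℕ) (SP SQ : List Step) →
    Rank P p i → Excursion P p SP →
    Rank (A ++ S ++ D ∷ B) p′ i → Excursion (A ++ S ++ D ∷ B) p′ SQ →
    (i ≢ i₀ → countU SQ ≡ countU SP) × (i ≡ i₀ → countU SQ ≡ countU SP + countU S)
lemma2p4 _ _ _ A S B refl (_ , _ , _ , _ , _ , _ , dyckS , _) _ _ _ rankE excursionE len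
         i _ _ _ _ rankP excursionP rankQ excursionQ
  with matched-upStep rankE excursionE len
... | X , M , refl , refl , dyckM
  rewrite excursion-size rankP excursionP | excursion-size rankQ excursionQ
        | ++-assoc X (U ∷ M) (D ∷ S ++ B) | ++-assoc X (U ∷ M) (S ++ D ∷ B)
  = distance-swap-unmatched X M S B dyckM dyckS i ,
    λ { refl → distance-swap-matched X M S B dyckM dyckS }
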